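{- For integers $n,l$: (1) if $2\leq l\leq n-1$, then $\{m+\binom{n-1}{l-1}: m\in S(n-1,l)\}\subseteq S(n,l)$; (2) if $3\leq l\leq n-2$, then $\{m+\binom{n-1}{l+1}: m\in S(n-1,l-1)\}\subseteq S(n,l)$; (3) if $3\leq l\leq n-3$, then $\{m_1+m_2+\binom{n-2}{l+1}+\binom{n-2}{l-2}: m_1,m_2\in S(n-2,l-1)\}\subseteq S(n,l)$.
   Context: $S(n,l)$ denotes the set of sizes $|\mathcal A|$ of maximal antichains $\mathcal A$ in the Boolean lattice $B_n$ (all subsets of $[n]$ ordered by inclusion) with $\mathcal A\subseteq\binom{[n]}{l}\cup\binom{[n]}{l+1}$, where $\binom{[n]}{j}$ is the family of $j$-element subsets of $[n]$; maximal means no subset of $[n]$ can be added while keeping the antichain property. -}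

module Defs where

open import Data.Nat using (ℕ; suc)
open import Data.Fin.Subset using (Subset; _⊆_; ∣_∣)
open import Data.List using (List; length)
open import Data.List.Membership.Propositional using (_∈_; _∉_)
open import Data.List.Relation.Unary.Unique.Propositional using (Unique)
open import Data.Product using (Σ; ∃; _×_)
open import Data.Sum using (_⊎_)
open import Relation.Binary.PropositionalEquality using (_≡_)

-- A family of subsets of [n] is a duplicate-free list of subsets
-- (Subset n = characteristic vectors over Fin n); its size is its length.

IsAntichain : {n : ℕ} → List (Subset n) → Set
IsAntichain 𝒜 = ∀ {A B} → A ∈ 𝒜 → B ∈ 𝒜 → A ⊆ B → A ≡ B

IsMaximalAntichain : {n : ℕ} → List (Subset n) → Set
IsMaximalAntichain {n} 𝒜 =
  IsAntichain 𝒜 ×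
  ((X : Subset n) → X ∉ 𝒜 → ∃ λ A → A ∈ 𝒜 × (X ⊆ A ⊎ A ⊆ X))

InLevels : {n : ℕ} → ℕ → List (Subset n) → Set
InLevels l 𝒜 = ∀ {A} → A ∈ 𝒜 → ∣ A ∣ ≡ l ⊎ ∣ A ∣ ≡ suc l

InS : ℕ → ℕ → ℕ → Set
InS n l m = Σ (List (Subset n)) λ 𝒜 →
  Unique 𝒜 × IsMaximalAntichain 𝒜 × InLevels l 𝒜 × length 𝒜 ≡ m

-- A maximal antichain on [n+1] is obtained by gluing a family F₀ of subsets of [n] (the sets
-- avoiding the new point) with a family F₁ (the sets containing it, with the point removed):
-- the glued family is a maximal antichain as soon as F₀ and F₁ are, and no member of F₀ lies
-- inside a member of F₁. Taking for one of the two families a full level of B_n gives (1) and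
-- (2); for (3) we glue the two families produced by (2) and (1) one dimension lower. In every
-- case the missing inclusions are excluded by comparing sizes.
module Submission where

open import Defs
open import Data.Nat using (ℕ; zero; suc; _+_; _∸_; _≤_; _<_; s≤s; _≤?_)
open import Data.Nat.Properties
open import Data.Nat.Combinatorics using (_C_; nCk+nC[k+1]≡[n+1]C[k+1])
open import Data.Nat.Solver using (module +-*-Solver)
open import Data.Product using (∃; _×_; _,_)
open import Data.Sum using (_⊎_; inj₁; inj₂)
import Data.Sum as Sum
open import Data.Empty using (⊥-elim)
open import Data.Vec using ([]; _∷_; here)
open import Data.Fin.Subset using (Subset; _⊆_; _⊈_; ∣_∣; inside; outside; ⊤; ⊥)
open import Data.Fin.Subset.Properties using (drop-∷-⊆; s⊆s; p⊆q⇒∣p∣≤∣q∣; ∣⊥∣≡0; ⊥⊆; ∣⊤∣≡n; ⊆⊤)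
open import Data.List using (List; []; _∷_; [_]; map; _++_; length)
open import Data.List.Properties using (length-++; length-map)
open import Data.List.Membership.Propositional using (_∈_; _∉_)
open import Data.List.Membership.Propositional.Properties using (∈-map⁺; ∈-map⁻; ∈-++⁺ˡ; ∈-++⁺ʳ; ∈-++⁻)
open import Data.List.Relation.Unary.Unique.Propositional using (Unique)
import Data.List.Relation.Unary.Unique.Propositional.Properties as Unique
import Data.List.Relation.Unary.All as All
import Data.List.Relation.Unary.Any as Any
import Data.List.Relation.Unary.AllPairs as AllPairs
open import Relation.Binary.PropositionalEquality using (_≡_; refl; sym; trans; cong; cong₂; subst; module ≡-Reasoning)
open import Relation.Nullary using (¬_; yes; no)

inside⊈outside : ∀ {n} {p q : Subset n} → inside ∷ p ⊈ outside ∷ q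
inside⊈outside p⊆q with p⊆q here
... | ()

∣q∣<∣p∣⇒p⊈q : ∀ {n} {p q : Subset n} → ∣ q ∣ < ∣ p ∣ → p ⊈ q
∣q∣<∣p∣⇒p⊈q ∣q∣<∣p∣ p⊆q = <⇒≱ ∣q∣<∣p∣ (p⊆q⇒∣p∣≤∣q∣ p⊆q)

p⊆q∧∣q∣≤∣p∣⇒p≡q : ∀ {n} {p q : Subset n} → p ⊆ q → ∣ q ∣ ≤ ∣ p ∣ → p ≡ q
p⊆q∧∣q∣≤∣p∣⇒p≡q {p = []}          {[]}          _   _         = refl
p⊆q∧∣q∣≤∣p∣⇒p≡q {p = outside ∷ p} {outside ∷ q} p⊆q ∣q∣≤∣p∣ =
  cong (outside ∷_) (p⊆q∧∣q∣≤∣p∣⇒p≡q (drop-∷-⊆ p⊆q) ∣q∣≤∣p∣)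
p⊆q∧∣q∣≤∣p∣⇒p≡q {p = inside ∷ p}  {inside ∷ q}  p⊆q (s≤s ∣q∣≤∣p∣) =
  cong (inside ∷_) (p⊆q∧∣q∣≤∣p∣⇒p≡q (drop-∷-⊆ p⊆q) ∣q∣≤∣p∣)
p⊆q∧∣q∣≤∣p∣⇒p≡q {p = inside ∷ p}  {outside ∷ q} p⊆q _ = ⊥-elim (inside⊈outside p⊆q)
p⊆q∧∣q∣≤∣p∣⇒p≡q {p = outside ∷ p} {inside ∷ q}  p⊆q ∣q∣≤∣p∣ =
  ⊥-elim (<⇒≱ ∣q∣≤∣p∣ (p⊆q⇒∣p∣≤∣q∣ (drop-∷-⊆ p⊆q)))

Comparable : ∀ {n} → Subset n → Subset n → Set
Comparable p q = p ⊆ q ⊎ q ⊆ p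

comparable-∷ : ∀ {n} x {p q : Subset n} → Comparable p q → Comparable (x ∷ p) (x ∷ q)
comparable-∷ _ = Sum.map s⊆s s⊆s

∃-comparable-of-size : ∀ {n} k → k ≤ n → (p : Subset n) → ∃ λ q → ∣ q ∣ ≡ k × Comparable p q
∃-comparable-of-size {n} zero _ p = ⊥ , ∣⊥∣≡0 n , inj₂ ⊥⊆
∃-comparable-of-size (suc k) (s≤s k≤n) (inside ∷ p) with ∃-comparable-of-size k k≤n p
... | q , ∣q∣≡k , p~q = inside ∷ q , cong suc ∣q∣≡k , comparable-∷ inside p~q
∃-comparable-of-size {suc n} (suc k) (s≤s k≤n) (outside ∷ p) with suc k ≤? n
... | yes k<n with ∃-comparable-of-size (suc k) k<n p
...   | q , ∣q∣≡1+k , p~q = outside ∷ q , ∣q∣≡1+k , comparable-∷ outside p~q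
∃-comparable-of-size {suc n} (suc k) (s≤s k≤n) (outside ∷ p) | no k≮n =
  ⊤ , trans (∣⊤∣≡n (suc n)) (cong suc (≤-antisym (≮⇒≥ k≮n) k≤n)) , inj₁ ⊆⊤

NoneBelow : ∀ {n} → List (Subset n) → List (Subset n) → Set
NoneBelow F G = ∀ {A B} → A ∈ F → B ∈ G → A ⊈ B

none-below-by-threshold : ∀ {n} {F G : List (Subset n)} b →
  (∀ {A} → A ∈ F → b < ∣ A ∣) → (∀ {B} → B ∈ G → ∣ B ∣ ≤ b) → NoneBelow F G
none-below-by-threshold b F-above G-below A∈F B∈G = ∣q∣<∣p∣⇒p⊈q (≤-<-trans (G-below B∈G) (F-above A∈F))

IsLevelMaxAntichain : ∀ {n} → ℕ → List (Subset n) → Set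
IsLevelMaxAntichain l F = Unique F × IsMaximalAntichain F × InLevels l F

module _ {n l : ℕ} {F : List (Subset n)} (F-levels : InLevels l F) where

  inLevels-lower : ∀ {A} → A ∈ F → l ≤ ∣ A ∣
  inLevels-lower A∈F with F-levels A∈F
  ... | inj₁ ∣A∣≡l   = ≤-reflexive (sym ∣A∣≡l)
  ... | inj₂ ∣A∣≡1+l = ≤-trans (n≤1+n l) (≤-reflexive (sym ∣A∣≡1+l))

  inLevels-upper : ∀ {A} → A ∈ F → ∣ A ∣ ≤ suc l
  inLevels-upper A∈F with F-levels A∈F
  ... | inj₁ ∣A∣≡l   = ≤-trans (≤-reflexive ∣A∣≡l) (n≤1+n l)
  ... | inj₂ ∣A∣≡1+l = ≤-reflexive ∣A∣≡1+l

glue : ∀ {n} → List (Subset n) → List (Subset n) → List (Subset (suc n))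
glue F₀ F₁ = map (outside ∷_) F₀ ++ map (inside ∷_) F₁

length-glue : ∀ {n} (F₀ F₁ : List (Subset n)) → length (glue F₀ F₁) ≡ length F₀ + length F₁
length-glue F₀ F₁ = trans (length-++ (map (outside ∷_) F₀))
  (cong₂ _+_ (length-map (outside ∷_) F₀) (length-map (inside ∷_) F₁))

module _ {n : ℕ} {F₀ F₁ : List (Subset n)} where

  ∈-glue-outside⁺ : ∀ {A} → A ∈ F₀ → outside ∷ A ∈ glue F₀ F₁
  ∈-glue-outside⁺ A∈F₀ = ∈-++⁺ˡ (∈-map⁺ (outside ∷_) A∈F₀)

  ∈-glue-inside⁺ : ∀ {A} → A ∈ F₁ → inside ∷ A ∈ glue F₀ F₁
  ∈-glue-inside⁺ A∈F₁ = ∈-++⁺ʳ (map (outside ∷_) F₀) (∈-map⁺ (inside ∷_) A∈F₁)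

  ∈-glue-outside⁻ : ∀ {A} → outside ∷ A ∈ glue F₀ F₁ → A ∈ F₀
  ∈-glue-outside⁻ A∈glue with ∈-++⁻ (map (outside ∷_) F₀) A∈glue
  ... | inj₁ A∈F₀′ with ∈-map⁻ (outside ∷_) A∈F₀′
  ...   | _ , A∈F₀ , refl = A∈F₀
  ∈-glue-outside⁻ A∈glue | inj₂ A∈F₁′ with ∈-map⁻ (inside ∷_) A∈F₁′
  ...   | _ , _ , ()

  ∈-glue-inside⁻ : ∀ {A} → inside ∷ A ∈ glue F₀ F₁ → A ∈ F₁
  ∈-glue-inside⁻ A∈glue with ∈-++⁻ (map (outside ∷_) F₀) A∈glue
  ... | inj₂ A∈F₁′ with ∈-map⁻ (inside ∷_) A∈F₁′
  ...   | _ , A∈F₁ , refl = A∈F₁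
  ∈-glue-inside⁻ A∈glue | inj₁ A∈F₀′ with ∈-map⁻ (outside ∷_) A∈F₀′
  ...   | _ , _ , ()

  glue-unique : Unique F₀ → Unique F₁ → Unique (glue F₀ F₁)
  glue-unique u₀ u₁ =
    Unique.++⁺ (Unique.map⁺ (λ { refl → refl }) u₀) (Unique.map⁺ (λ { refl → refl }) u₁) disjoint
    where
    disjoint : ∀ {A} → ¬ (A ∈ map (outside ∷_) F₀ × A ∈ map (inside ∷_) F₁)
    disjoint (A∈F₀′ , A∈F₁′) with ∈-map⁻ (outside ∷_) A∈F₀′ | ∈-map⁻ (inside ∷_) A∈F₁′
    ... | _ , _ , refl | _ , _ , ()

  glue-size : (P : ℕ → Set) → (∀ {A} → A ∈ F₀ → P ∣ A ∣) → (∀ {A} → A ∈ F₁ → P (suc ∣ A ∣)) →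
    ∀ {A} → A ∈ glue F₀ F₁ → P ∣ A ∣
  glue-size P P₀ P₁ {outside ∷ A} A∈glue = P₀ (∈-glue-outside⁻ A∈glue)
  glue-size P P₀ P₁ {inside ∷ A}  A∈glue = P₁ (∈-glue-inside⁻ A∈glue)

  glue-inLevels : ∀ {l} → InLevels (suc l) F₀ → InLevels l F₁ → InLevels (suc l) (glue F₀ F₁)
  glue-inLevels {l} levels₀ levels₁ =
    glue-size (λ k → k ≡ suc l ⊎ k ≡ suc (suc l)) levels₀ (λ A∈F₁ → Sum.map (cong suc) (cong suc) (levels₁ A∈F₁))

  glue-isMaximalAntichain : IsMaximalAntichain F₀ → IsMaximalAntichain F₁ → NoneBelow F₀ F₁ →
    IsMaximalAntichain (glue F₀ F₁)
  glue-isMaximalAntichain (antichain₀ , maximal₀) (antichain₁ , maximal₁) F₀⋡F₁ = antichain , maximal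
    where
    antichain : IsAntichain (glue F₀ F₁)
    antichain {outside ∷ A} {outside ∷ B} A∈ B∈ A⊆B =
      cong (outside ∷_) (antichain₀ (∈-glue-outside⁻ A∈) (∈-glue-outside⁻ B∈) (drop-∷-⊆ A⊆B))
    antichain {outside ∷ A} {inside ∷ B}  A∈ B∈ A⊆B =
      ⊥-elim (F₀⋡F₁ (∈-glue-outside⁻ A∈) (∈-glue-inside⁻ B∈) (drop-∷-⊆ A⊆B))
    antichain {inside ∷ A}  {outside ∷ B} A∈ B∈ A⊆B = ⊥-elim (inside⊈outside A⊆B)
    antichain {inside ∷ A}  {inside ∷ B}  A∈ B∈ A⊆B =
      cong (inside ∷_) (antichain₁ (∈-glue-inside⁻ A∈) (∈-glue-inside⁻ B∈) (drop-∷-⊆ A⊆B))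
    maximal : (X : Subset (suc n)) → X ∉ glue F₀ F₁ → ∃ λ A → A ∈ glue F₀ F₁ × Comparable X A
    maximal (outside ∷ X) X∉ with maximal₀ X (λ X∈F₀ → X∉ (∈-glue-outside⁺ X∈F₀))
    ... | A , A∈F₀ , X~A = outside ∷ A , ∈-glue-outside⁺ A∈F₀ , comparable-∷ outside X~A
    maximal (inside ∷ X) X∉ with maximal₁ X (λ X∈F₁ → X∉ (∈-glue-inside⁺ X∈F₁))
    ... | A , A∈F₁ , X~A = inside ∷ A , ∈-glue-inside⁺ A∈F₁ , comparable-∷ inside X~A

  glue-isLevelMaxAntichain : ∀ {l} → IsLevelMaxAntichain (suc l) F₀ → IsLevelMaxAntichain l F₁ →
    NoneBelow F₀ F₁ → IsLevelMaxAntichain (suc l) (glue F₀ F₁)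
  glue-isLevelMaxAntichain (u₀ , max₀ , levels₀) (u₁ , max₁ , levels₁) F₀⋡F₁ =
    glue-unique u₀ u₁ , glue-isMaximalAntichain max₀ max₁ F₀⋡F₁ , glue-inLevels levels₀ levels₁

glue-none-below : ∀ {n} {F₀ F₁ G₀ G₁ : List (Subset n)} →
  NoneBelow F₀ G₀ → NoneBelow F₀ G₁ → NoneBelow F₁ G₁ → NoneBelow (glue F₀ F₁) (glue G₀ G₁)
glue-none-below F₀⋡G₀ F₀⋡G₁ F₁⋡G₁ {outside ∷ A} {outside ∷ B} A∈ B∈ A⊆B =
  F₀⋡G₀ (∈-glue-outside⁻ A∈) (∈-glue-outside⁻ B∈) (drop-∷-⊆ A⊆B)
glue-none-below F₀⋡G₀ F₀⋡G₁ F₁⋡G₁ {outside ∷ A} {inside ∷ B}  A∈ B∈ A⊆B =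
  F₀⋡G₁ (∈-glue-outside⁻ A∈) (∈-glue-inside⁻ B∈) (drop-∷-⊆ A⊆B)
glue-none-below F₀⋡G₀ F₀⋡G₁ F₁⋡G₁ {inside ∷ A}  {outside ∷ B} A∈ B∈ A⊆B = inside⊈outside A⊆B
glue-none-below F₀⋡G₀ F₀⋡G₁ F₁⋡G₁ {inside ∷ A}  {inside ∷ B}  A∈ B∈ A⊆B =
  F₁⋡G₁ (∈-glue-inside⁻ A∈) (∈-glue-inside⁻ B∈) (drop-∷-⊆ A⊆B)

level : (n k : ℕ) → List (Subset n)
level zero    zero    = [ [] ]
level zero    (suc k) = []
level (suc n) zero    = glue (level n zero) []
level (suc n) (suc k) = glue (level n (suc k)) (level n k)

length-level : ∀ n k → length (level n k) ≡ n C k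
length-level zero    zero    = refl
length-level zero    (suc k) = refl
length-level (suc n) zero    = begin
  length (glue (level n zero) [])  ≡⟨ length-glue (level n zero) [] ⟩
  length (level n zero) + 0        ≡⟨ +-identityʳ _ ⟩
  length (level n zero)            ≡⟨ length-level n zero ⟩
  n C 0                            ∎
  where open ≡-Reasoning
length-level (suc n) (suc k) = begin
  length (glue (level n (suc k)) (level n k))        ≡⟨ length-glue (level n (suc k)) (level n k) ⟩
  length (level n (suc k)) + length (level n k)      ≡⟨ cong₂ _+_ (length-level n (suc k)) (length-level n k) ⟩
  n C suc k + n C k                                  ≡⟨ +-comm (n C suc k) (n C k) ⟩
  n C k + n C suc k                                  ≡⟨ nCk+nC[k+1]≡[n+1]C[k+1] n k ⟩
  suc n C suc k                                      ∎
  where open ≡-Reasoning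

level-unique : ∀ n k → Unique (level n k)
level-unique zero    zero    = All.[] AllPairs.∷ AllPairs.[]
level-unique zero    (suc k) = AllPairs.[]
level-unique (suc n) zero    = glue-unique (level-unique n zero) AllPairs.[]
level-unique (suc n) (suc k) = glue-unique (level-unique n (suc k)) (level-unique n k)

∈-level⁻ : ∀ n k {A} → A ∈ level n k → ∣ A ∣ ≡ k
∈-level⁻ zero    zero    (Any.here refl) = refl
∈-level⁻ zero    zero    (Any.there ())
∈-level⁻ (suc n) zero    = glue-size (_≡ zero) (∈-level⁻ n zero) (λ ())
∈-level⁻ (suc n) (suc k) = glue-size (_≡ suc k) (∈-level⁻ n (suc k)) (λ A∈ → cong suc (∈-level⁻ n k A∈))

∈-level⁺ : ∀ {n} k (A : Subset n) → ∣ A ∣ ≡ k → A ∈ level n k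
∈-level⁺ zero    []            refl = Any.here refl
∈-level⁺ zero    (outside ∷ A) ∣A∣≡0   = ∈-glue-outside⁺ (∈-level⁺ zero A ∣A∣≡0)
∈-level⁺ (suc k) (outside ∷ A) ∣A∣≡1+k = ∈-glue-outside⁺ (∈-level⁺ (suc k) A ∣A∣≡1+k)
∈-level⁺ (suc k) (inside ∷ A)  refl    = ∈-glue-inside⁺ (∈-level⁺ k A refl)

level-isMaximalAntichain : ∀ n k → k ≤ n → IsMaximalAntichain (level n k)
level-isMaximalAntichain n k k≤n = antichain , maximal
  where
  antichain : IsAntichain (level n k)
  antichain A∈ B∈ A⊆B = p⊆q∧∣q∣≤∣p∣⇒p≡q A⊆B (≤-reflexive (trans (∈-level⁻ n k B∈) (sym (∈-level⁻ n k A∈))))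
  maximal : (X : Subset n) → X ∉ level n k → ∃ λ A → A ∈ level n k × Comparable X A
  maximal X _ with ∃-comparable-of-size k k≤n X
  ... | A , ∣A∣≡k , X~A = A , ∈-level⁺ k A ∣A∣≡k , X~A

level-isLevelMaxAntichain : ∀ n k → k ≤ n → IsLevelMaxAntichain k (level n k)
level-isLevelMaxAntichain n k k≤n =
  level-unique n k , level-isMaximalAntichain n k k≤n , λ A∈ → inj₁ (∈-level⁻ n k A∈)

level-suc-isLevelMaxAntichain : ∀ n k → suc k ≤ n → IsLevelMaxAntichain k (level n (suc k))
level-suc-isLevelMaxAntichain n k k<n =
  level-unique n (suc k) , level-isMaximalAntichain n (suc k) k<n , λ A∈ → inj₂ (∈-level⁻ n (suc k) A∈)

glue-level-below : ∀ {n l} {F : List (Subset n)} → l ≤ n →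
  IsLevelMaxAntichain (suc l) F → IsLevelMaxAntichain (suc l) (glue F (level n l))
glue-level-below {n} {l} l≤n F-lma@(_ , _ , F-levels) =
  glue-isLevelMaxAntichain F-lma (level-isLevelMaxAntichain n l l≤n)
    (none-below-by-threshold l (inLevels-lower F-levels) (λ B∈ → ≤-reflexive (∈-level⁻ n l B∈)))

glue-level-above : ∀ {n l} {F : List (Subset n)} → suc (suc l) ≤ n →
  IsLevelMaxAntichain l F → IsLevelMaxAntichain (suc l) (glue (level n (suc (suc l))) F)
glue-level-above {n} {l} l+2≤n F-lma@(_ , _ , F-levels) =
  glue-isLevelMaxAntichain (level-suc-isLevelMaxAntichain n (suc l) l+2≤n) F-lma
    (none-below-by-threshold (suc l) (λ A∈ → ≤-reflexive (sym (∈-level⁻ n (suc (suc l)) A∈))) (inLevels-upper F-levels))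

glue-level-above-below : ∀ {n k} {F₁ F₂ : List (Subset n)} → 3 + k ≤ n →
  IsLevelMaxAntichain (suc k) F₁ → IsLevelMaxAntichain (suc k) F₂ →
  IsLevelMaxAntichain (2 + k) (glue (glue (level n (3 + k)) F₁) (glue F₂ (level n k)))
glue-level-above-below {n} {k} k+3≤n F₁-lma@(_ , _ , F₁-levels) F₂-lma@(_ , _ , F₂-levels) =
  glue-isLevelMaxAntichain (glue-level-above k+3≤n F₁-lma) (glue-level-below k≤n F₂-lma)
    (glue-none-below (none-below-by-threshold (2 + k) ∈-level-3+k (inLevels-upper F₂-levels))
                     (none-below-by-threshold (2 + k) ∈-level-3+k (λ B∈ → ≤-trans (∈-level-k B∈) (m≤n+m k 2)))
                     (none-below-by-threshold k (inLevels-lower F₁-levels) ∈-level-k))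
  where
  k≤n : k ≤ n
  k≤n = ≤-trans (m≤n+m k 3) k+3≤n
  ∈-level-3+k : ∀ {A} → A ∈ level n (3 + k) → 2 + k < ∣ A ∣
  ∈-level-3+k A∈ = ≤-reflexive (sym (∈-level⁻ n (3 + k) A∈))
  ∈-level-k : ∀ {B} → B ∈ level n k → ∣ B ∣ ≤ k
  ∈-level-k B∈ = ≤-reflexive (∈-level⁻ n k B∈)

isLevelMaxAntichain⇒InS : ∀ {n l m} {F : List (Subset n)} → IsLevelMaxAntichain l F → length F ≡ m → InS n l m
isLevelMaxAntichain⇒InS {F = F} (u , max , levels) ∣F∣≡m = F , u , max , levels , ∣F∣≡m

InS-glue-level-below : ∀ {n l m} → l ≤ n → InS n (suc l) m → InS (suc n) (suc l) (m + n C l)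
InS-glue-level-below {n} {l} l≤n (F , u , max , levels , refl) =
  isLevelMaxAntichain⇒InS (glue-level-below l≤n (u , max , levels))
    (trans (length-glue F (level n l)) (cong (length F +_) (length-level n l)))

InS-glue-level-above : ∀ {n l m} → 2 + l ≤ n → InS n l m → InS (suc n) (suc l) (m + n C (2 + l))
InS-glue-level-above {n} {l} l+2≤n (F , u , max , levels , refl) =
  isLevelMaxAntichain⇒InS (glue-level-above l+2≤n (u , max , levels)) (begin
    length (glue (level n (2 + l)) F)   ≡⟨ length-glue (level n (2 + l)) F ⟩
    length (level n (2 + l)) + length F ≡⟨ cong (_+ length F) (length-level n (2 + l)) ⟩
    n C (2 + l) + length F              ≡⟨ +-comm (n C (2 + l)) (length F) ⟩
    length F + n C (2 + l)              ∎)
  where open ≡-Reasoning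

InS-glue-level-above-below : ∀ {n k m₁ m₂} → 3 + k ≤ n → InS n (suc k) m₁ → InS n (suc k) m₂ →
  InS (2 + n) (2 + k) (m₁ + m₂ + n C (3 + k) + n C k)
InS-glue-level-above-below {n} {k} k+3≤n (F₁ , u₁ , max₁ , levels₁ , refl) (F₂ , u₂ , max₂ , levels₂ , refl) =
  isLevelMaxAntichain⇒InS (glue-level-above-below k+3≤n (u₁ , max₁ , levels₁) (u₂ , max₂ , levels₂)) (begin
    length (glue (glue (level n (3 + k)) F₁) (glue F₂ (level n k)))
      ≡⟨ length-glue (glue (level n (3 + k)) F₁) (glue F₂ (level n k)) ⟩
    length (glue (level n (3 + k)) F₁) + length (glue F₂ (level n k))
      ≡⟨ cong₂ _+_ (length-glue (level n (3 + k)) F₁) (length-glue F₂ (level n k)) ⟩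
    length (level n (3 + k)) + length F₁ + (length F₂ + length (level n k))
      ≡⟨ cong₂ (λ a b → a + length F₁ + (length F₂ + b)) (length-level n (3 + k)) (length-level n k) ⟩
    n C (3 + k) + length F₁ + (length F₂ + n C k)
      ≡⟨ rearrange (n C (3 + k)) (length F₁) (length F₂) (n C k) ⟩
    length F₁ + length F₂ + n C (3 + k) + n C k ∎)
  where
  open ≡-Reasoning
  rearrange : ∀ a b c d → a + b + (c + d) ≡ b + c + a + d
  rearrange = +-*-Solver.solve 4 (λ a b c d → a :+ b :+ (c :+ d) := b :+ c :+ a :+ d) refl
    where open +-*-Solver

lemma3p2 : (n l : ℕ) →
    (2 ≤ l → l ≤ n ∸ 1 → (m : ℕ) → InS (n ∸ 1) l m →
      InS n l (m + (n ∸ 1) C (l ∸ 1)))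
    × (3 ≤ l → l ≤ n ∸ 2 → (m : ℕ) → InS (n ∸ 1) (l ∸ 1) m →
      InS n l (m + (n ∸ 1) C (l + 1)))
    × (3 ≤ l → l ≤ n ∸ 3 → (m₁ m₂ : ℕ) → InS (n ∸ 2) (l ∸ 1) m₁ → InS (n ∸ 2) (l ∸ 1) m₂ →
      InS n l (m₁ + m₂ + (n ∸ 2) C (l + 1) + (n ∸ 2) C (l ∸ 2)))
lemma3p2 n l = part₁ n l , part₂ n l , part₃ n l
  where
  part₁ : ∀ n l → 2 ≤ l → l ≤ n ∸ 1 → (m : ℕ) → InS (n ∸ 1) l m → InS n l (m + (n ∸ 1) C (l ∸ 1))
  part₁ zero    (suc l) _ ()
  part₁ (suc n) (suc l) _ l<n m = InS-glue-level-below (<⇒≤ l<n)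

  part₂ : ∀ n l → 3 ≤ l → l ≤ n ∸ 2 → (m : ℕ) → InS (n ∸ 1) (l ∸ 1) m → InS n l (m + (n ∸ 1) C (l + 1))
  part₂ zero          (suc l) _ ()
  part₂ (suc zero)    (suc l) _ ()
  part₂ (suc (suc n)) (suc l) _ l<n m 𝒜 =
    subst (λ j → InS (2 + n) (suc l) (m + suc n C j)) (+-comm 1 (suc l)) (InS-glue-level-above (s≤s l<n) 𝒜)

  part₃ : ∀ n l → 3 ≤ l → l ≤ n ∸ 3 → (m₁ m₂ : ℕ) → InS (n ∸ 2) (l ∸ 1) m₁ → InS (n ∸ 2) (l ∸ 1) m₂ →
    InS n l (m₁ + m₂ + (n ∸ 2) C (l + 1) + (n ∸ 2) C (l ∸ 2))
  part₃ _                   (suc zero)    (s≤s ())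
  part₃ zero                (suc (suc k)) _ ()
  part₃ (suc zero)          (suc (suc k)) _ ()
  part₃ (suc (suc zero))    (suc (suc k)) _ ()
  part₃ (suc (suc (suc n))) (suc (suc k)) _ k+2≤n m₁ m₂ 𝒜₁ 𝒜₂ =
    subst (λ j → InS (3 + n) (2 + k) (m₁ + m₂ + suc n C j + suc n C k)) (+-comm 1 (2 + k))
      (InS-glue-level-above-below (s≤s k+2≤n) 𝒜₁ 𝒜₂)
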